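{- There exists $n_0$ such that every graph $G$ on $n\ge n_0$ vertices satisfies $\dim_{\mathrm{TH}}(G)\le n-0.72\ln n$.
   Context: A graph $H$ on $N$ vertices is a threshold graph if there exist real numbers $a_1,\dots,a_N,b$ such that the $0$-$1$ solutions of $\sum a_ix_i\le b$ are exactly the characteristic vectors of the cliques of $H$ (equivalently, $H$ has no induced $2K_2$, $P_4$ or $C_4$). The threshold dimension $\dim_{\mathrm{TH}}(G)$ is the smallest $k$ such that there are threshold graphs $G_1,\dots,G_k$ on $V(G)$ with $E(G)=\bigcap_i E(G_i)$. -}

module Defs where

open import Data.Nat using (ℕ; zero; suc; _+_; _*_; _∸_; _^_; _≤_)
open import Data.Integer as ℤ using (ℤ; 0ℤ)
open import Data.Fin using (Fin; zero; suc)
open import Data.Bool using (Bool; true; false; if_then_else_)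
open import Data.Product using (Σ; ∃; _×_; _,_)
open import Relation.Binary.PropositionalEquality using (_≡_; _≢_)
open import Relation.Nullary using (¬_)

record Graph (n : ℕ) : Set where
  field
    adj    : Fin n → Fin n → Bool
    sym    : ∀ u v → adj u v ≡ adj v u
    irrefl : ∀ u → adj u u ≡ false
open Graph public

sumFin : ∀ {n} → (Fin n → ℤ) → ℤ
sumFin {zero}  f = 0ℤ
sumFin {suc n} f = f zero ℤ.+ sumFin (λ i → f (suc i))

weight : ∀ {n} → (Fin n → ℤ) → (Fin n → Bool) → ℤ
weight a x = sumFin (λ i → if x i then a i else 0ℤ)

IsClique : ∀ {n} → Graph n → (Fin n → Bool) → Set
IsClique H x = ∀ u v → x u ≡ true → x v ≡ true → u ≢ v → adj H u v ≡ true

-- Threshold graph: weights a_1..a_N and b such that the 0-1 solutions of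
-- Σ a_i x_i ≤ b are exactly the clique vectors.  (Integer weights: any
-- real solution of this finite system yields a rational, hence integer one.)
IsThreshold : ∀ {n} → Graph n → Set
IsThreshold {n} H =
  Σ (Fin n → ℤ) λ a → Σ ℤ λ b →
    ∀ (x : Fin n → Bool) →
      ((weight a x ℤ.≤ b → IsClique H x) × (IsClique H x → weight a x ℤ.≤ b))

ThresholdRep : ∀ {n} → Graph n → ℕ → Set
ThresholdRep {n} G k =
  Σ (Fin k → Graph n) λ Gs →
    (∀ i → IsThreshold (Gs i)) ×
    (∀ u v → u ≢ v →
       ((adj G u v ≡ true → ∀ i → adj (Gs i) u v ≡ true) ×
        ((∀ i → adj (Gs i) u v ≡ true) → adj G u v ≡ true)))

-- dim_TH(G) ≤ k  :⇔  G is an intersection of k threshold graphs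
-- (dim_TH is the least such k).
dimTH≤ : ∀ {n} → Graph n → ℕ → Set
dimTH≤ G k = ThresholdRep G k

-- _! and scaled exponential partial sums:
-- expNum x N = N! · Σ_{j=0}^{N} x^j / j!   (a natural number)
fact : ℕ → ℕ
fact zero    = 1
fact (suc n) = suc n * fact n

expNum : ℕ → ℕ → ℕ
expNum x zero    = 1
expNum x (suc N) = suc N * expNum x N + x ^ suc N

-- e^x ≥ y (x, y natural)  ⇔  some exponential partial sum reaches y
-- (partial sums increase to e^x; equality e^x = y forces x = 0, y = 1).
ExpGe : ℕ → ℕ → Set
ExpGe x y = ∃ λ N → y * fact N ≤ expNum x N

-- k ≤ n - 0.72 ln n   for n ≥ 1, k natural.
-- Since 0.72 = 18/25 and ln n ≥ 0 this is:  k ≤ n  and  n^18 ≤ e^{25 (n - k)}.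
LeNMinus072Ln : ℕ → ℕ → Set
LeNMinus072Ln k n = (k ≤ n) × ExpGe (25 * (n ∸ k)) (n ^ 18)

{-# OPTIONS --safe #-}
-- By the Erdős–Szekeres bound, a graph G on n ≥ 4^c vertices has a clique or an independent
-- set S with more than c vertices.  G is then the intersection of n - |S| + 1 threshold graphs:
-- one that agrees with G on S and is complete elsewhere, and for each vertex w outside S the
-- complete graph minus the non-edges of G at w.  Each of them is a complete graph minus all
-- edges joining a "centre" to a centre or a "leaf", and such graphs are threshold.  Hence
-- dim_TH(G) ≤ n - c, and c ≈ log₄ n suffices because 0.72 < 1/ln 4.  The inequality
-- n^18 ≤ e^(25c) is reduced, one block of 200 base-4 digits of n at a time, to the single
-- numerical fact 5000^5000/5000! ≥ 2^7205, using that the terms x^m/m! of the exponential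
-- series are multiplicative up to a binomial coefficient.
module Submission where

open import Defs hiding (sym)
import Algebra.Properties.Monoid.Sum as MonoidSum
open import Data.Bool as Bool using (Bool; true; false; if_then_else_)
open import Data.Bool.Properties using (if-float; ¬-not)
open import Data.Fin using (Fin; zero; suc; _≟_)
open import Data.Fin.Properties using (any?; suc-injective)
open import Data.Integer as ℤ using (+≤+)
open import Data.Integer.Properties using (drop‿+≤+)
open import Data.List using (List; []; _∷_; length; lookup; filter; allFin)
open import Data.List.Properties using (length-tabulate)
open import Data.List.Membership.Propositional using (_∈_)
open import Data.List.Membership.Propositional.Properties using (∈-filter⁻; ∈-allFin)
open import Data.List.Relation.Unary.Any using (here; there; index)
open import Data.List.Relation.Unary.Any.Properties using (lookup-index)
open import Data.List.Relation.Binary.Sublist.Propositional using (_⊆_; []; _∷_; _∷ʳ_; minimum; ⊆-trans)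
import Data.List.Relation.Binary.Sublist.Propositional as Sublist
open import Data.List.Relation.Binary.Sublist.Propositional.Properties using (filter-⊆; length-mono-≤)
open import Data.List.Relation.Ternary.Interleaving.Properties using (interleave-length)
import Data.List.Relation.Ternary.Interleaving.Propositional.Properties as Interleaving
open import Data.Nat using (ℕ; zero; suc; _+_; _*_; _∸_; _^_; _!; _≤_; _<_; _≤?_; _<?_; z≤n; s≤s; z<s; NonZero; >-nonZero)
open import Data.Nat.Properties
  using ( module ≤-Reasoning; ≤-refl; ≤-reflexive; ≤-trans; <-trans; ≤-<-trans; <-≤-trans; <-irrefl
        ; <⇒≤; <⇒≱; ≰⇒>; ≮⇒≥; n≤1+n; m≤n⇒m≤1+n; ≤ᵇ⇒≤
        ; +-comm; +-suc; +-identityʳ; +-mono-≤; +-monoˡ-≤; +-monoʳ-≤; +-cancelˡ-≤; m≤m+n; m≤n+m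
        ; m+n∸m≡n; m+[n∸m]≡n; m+n≤o⇒n≤o; m+n≤o⇒m≤o∸n; +-0-monoid
        ; *-comm; *-identityˡ; *-identityʳ; *-mono-≤; *-monoˡ-≤; *-monoʳ-≤; *-cancelʳ-≤; m<m*n
        ; ^-monoˡ-≤; ^-monoʳ-≤; ^-*-assoc; m^n>0; m^n≢0; _!*_!≢0 )
open import Data.Nat.Tactic.RingSolver using (solve-∀)
open import Data.Product using (∃; _×_; _,_; proj₁; proj₂)
open import Data.Sum using (_⊎_; inj₁; inj₂; map₁; map₂; [_,_]′)
open import Function using (_∘_; id)
open import Relation.Binary.PropositionalEquality
  using (_≡_; _≢_; refl; sym; trans; cong; cong₂; subst; module ≡-Reasoning)
open import Relation.Nullary using (Dec; yes; no; ¬_; ¬?; does; contradiction)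
open import Relation.Nullary.Decidable using (dec-true; dec-false; _×-dec_)
open import Relation.Unary using (Decidable)

open MonoidSum +-0-monoid using (sum; sum-cong-≗; sum-replicate-zero)

restrict : ∀ {n} → (Fin n → ℕ) → (Fin n → Bool) → Fin n → ℕ
restrict w x i = if x i then w i else 0

restrict-selected : ∀ {n} (w : Fin n → ℕ) x {i} → x i ≡ true → restrict w x i ≡ w i
restrict-selected w x xi rewrite xi = refl

weight-+ : ∀ {n} (w : Fin n → ℕ) x → weight (λ i → ℤ.+ w i) x ≡ ℤ.+ sum (restrict w x)
weight-+ {zero}  w x = refl
weight-+ {suc n} w x = cong₂ ℤ._+_ (sym (if-float ℤ.+_ (x zero))) (weight-+ (w ∘ suc) (x ∘ suc))

sum≤n*m : ∀ {n m} (f : Fin n → ℕ) → (∀ i → f i ≤ m) → sum f ≤ n * m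
sum≤n*m {zero}  f f≤m = z≤n
sum≤n*m {suc n} f f≤m = +-mono-≤ (f≤m zero) (sum≤n*m (f ∘ suc) (f≤m ∘ suc))

f[i]≤sum : ∀ {n} (f : Fin n → ℕ) i → f i ≤ sum f
f[i]≤sum f zero    = m≤m+n (f zero) _
f[i]≤sum f (suc i) = ≤-trans (f[i]≤sum (f ∘ suc) i) (m≤n+m _ (f zero))

f[i]+f[j]≤sum : ∀ {n} (f : Fin n → ℕ) {i j} → i ≢ j → f i + f j ≤ sum f
f[i]+f[j]≤sum f {zero}  {zero}  i≢j = contradiction refl i≢j
f[i]+f[j]≤sum f {zero}  {suc j} _   = +-monoʳ-≤ (f zero) (f[i]≤sum (f ∘ suc) j)
f[i]+f[j]≤sum f {suc i} {zero}  _   =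
  subst (_≤ sum f) (+-comm (f zero) (f (suc i))) (+-monoʳ-≤ (f zero) (f[i]≤sum (f ∘ suc) i))
f[i]+f[j]≤sum f {suc i} {suc j} i≢j = ≤-trans (f[i]+f[j]≤sum (f ∘ suc) (i≢j ∘ cong suc)) (m≤n+m _ (f zero))

sum-concentrated : ∀ {n} (f : Fin n → ℕ) {i} → (∀ j → j ≢ i → f j ≡ 0) → sum f ≡ f i
sum-concentrated {suc n} f {zero} rest-zero = begin
  f zero + sum (f ∘ suc)  ≡⟨ cong (f zero +_) (trans (sum-cong-≗ (λ j → rest-zero (suc j) λ ())) (sum-replicate-zero n)) ⟩
  f zero + 0              ≡⟨ +-identityʳ (f zero) ⟩
  f zero                  ∎
  where open ≡-Reasoning
sum-concentrated f {suc i} rest-zero = begin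
  f zero + sum (f ∘ suc)  ≡⟨ cong (_+ sum (f ∘ suc)) (rest-zero zero λ ()) ⟩
  sum (f ∘ suc)           ≡⟨ sum-concentrated (f ∘ suc) (λ j j≢i → rest-zero (suc j) (j≢i ∘ suc-injective)) ⟩
  f (suc i)               ∎
  where open ≡-Reasoning

data Role : Set where
  centre leaf free : Role

centre? : (r : Role) → Dec (r ≡ centre)
centre? centre = yes refl
centre? leaf   = no λ ()
centre? free   = no λ ()

compatible : Role → Role → Bool
compatible centre centre = false
compatible centre leaf   = false
compatible leaf   centre = false
compatible _      _      = true

compatible-sym : ∀ r s → compatible r s ≡ compatible s r
compatible-sym centre centre = refl
compatible-sym centre leaf   = refl
compatible-sym centre free   = refl
compatible-sym leaf   centre = refl
compatible-sym leaf   leaf   = refl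
compatible-sym leaf   free   = refl
compatible-sym free   centre = refl
compatible-sym free   leaf   = refl
compatible-sym free   free   = refl

compatible-free : ∀ r → compatible r free ≡ true
compatible-free centre = refl
compatible-free leaf   = refl
compatible-free free   = refl

compatible-centre : ∀ {r} → compatible centre r ≡ true → r ≡ free
compatible-centre {free} _ = refl

neighbourRole : Bool → Role
neighbourRole true  = free
neighbourRole false = leaf

compatible-centre-neighbour : ∀ b → compatible centre (neighbourRole b) ≡ b
compatible-centre-neighbour true  = refl
compatible-centre-neighbour false = refl

compatible-neighbours : ∀ a b → compatible (neighbourRole a) (neighbourRole b) ≡ true
compatible-neighbours true  _     = refl
compatible-neighbours false true  = refl
compatible-neighbours false false = refl

roleGraph : ∀ {n} → (Fin n → Role) → Graph n
roleGraph {n} role = record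
  { adj    = adjacent
  ; sym    = adjacent-sym
  ; irrefl = λ u → cong (if_then false else compatible (role u) (role u)) (dec-true (u ≟ u) refl)
  }
  where
  adjacent : Fin n → Fin n → Bool
  adjacent u v = if does (u ≟ v) then false else compatible (role u) (role v)
  adjacent-sym : ∀ u v → adjacent u v ≡ adjacent v u
  adjacent-sym u v with u ≟ v
  ... | yes refl rewrite dec-true (u ≟ u) refl = refl
  ... | no u≢v rewrite dec-false (v ≟ u) (u≢v ∘ sym) = compatible-sym (role u) (role v)

roleGraph-adj : ∀ {n} (role : Fin n → Role) {u v} → u ≢ v →
                adj (roleGraph role) u v ≡ compatible (role u) (role v)
roleGraph-adj role {u} {v} u≢v = cong (if_then false else compatible (role u) (role v)) (dec-false (u ≟ v) u≢v)

module _ {n} (role : Fin n → Role) where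

  -- A centre outweighs all leaves together, so weight ≤ n + 1 allows either no centre, or one
  -- centre and otherwise only free vertices: exactly the cliques of roleGraph role.
  roleWeight : Role → ℕ
  roleWeight centre = suc n
  roleWeight leaf   = 1
  roleWeight free   = 0

  private
    w : Fin n → ℕ
    w = roleWeight ∘ role

  incompatible⇒heavy : ∀ r s → compatible r s ≡ false → suc (suc n) ≤ roleWeight r + roleWeight s
  incompatible⇒heavy centre centre _ = s≤s (m≤n+m (suc n) n)
  incompatible⇒heavy centre leaf   _ = s≤s (≤-reflexive (sym (+-comm n 1)))
  incompatible⇒heavy leaf   centre _ = ≤-refl

  light⇒clique : ∀ x → sum (restrict w x) ≤ suc n → IsClique (roleGraph role) x
  light⇒clique x light u v xu xv u≢v = trans (roleGraph-adj role u≢v) (¬-not λ incompatible →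
    <-irrefl refl (begin
      suc (suc n)                       ≤⟨ incompatible⇒heavy (role u) (role v) incompatible ⟩
      w u + w v                         ≡⟨ cong₂ _+_ (restrict-selected w x xu) (restrict-selected w x xv) ⟨
      restrict w x u + restrict w x v   ≤⟨ f[i]+f[j]≤sum (restrict w x) u≢v ⟩
      sum (restrict w x)                ≤⟨ light ⟩
      suc n                             ∎))
    where open ≤-Reasoning

  clique⇒light : ∀ x → IsClique (roleGraph role) x → sum (restrict w x) ≤ suc n
  clique⇒light x clique with any? (λ c → (x c Bool.≟ true) ×-dec centre? (role c))
  ... | yes (c , xc , c-centre) = ≤-reflexive (begin
    sum (restrict w x)  ≡⟨ sum-concentrated (restrict w x) others-free ⟩
    restrict w x c      ≡⟨ restrict-selected w x xc ⟩
    roleWeight (role c) ≡⟨ cong roleWeight c-centre ⟩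
    suc n               ∎)
    where
    open ≡-Reasoning
    others-free : ∀ v → v ≢ c → restrict w x v ≡ 0
    others-free v v≢c with x v in xv
    ... | false = refl
    ... | true  = cong roleWeight (compatible-centre (begin
      compatible centre (role v)     ≡⟨ cong (λ r → compatible r (role v)) c-centre ⟨
      compatible (role c) (role v)   ≡⟨ roleGraph-adj role (v≢c ∘ sym) ⟨
      adj (roleGraph role) c v       ≡⟨ clique c v xc xv (v≢c ∘ sym) ⟩
      true                           ∎))
  ... | no no-centre = ≤-trans (sum≤n*m (restrict w x) at-most-1) (≤-trans (≤-reflexive (*-identityʳ n)) (n≤1+n n))
    where
    at-most-1 : ∀ v → restrict w x v ≤ 1
    at-most-1 v with x v in xv | role v in rv
    ... | false | _      = z≤n
    ... | true  | centre = contradiction (v , xv , rv) no-centre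
    ... | true  | leaf   = ≤-refl
    ... | true  | free   = z≤n

  roleGraph-isThreshold : IsThreshold (roleGraph role)
  roleGraph-isThreshold = (λ i → ℤ.+ w i) , ℤ.+ suc n , λ x →
    (λ light → light⇒clique x (drop‿+≤+ (subst (ℤ._≤ ℤ.+ suc n) (weight-+ w x) light))) ,
    (λ clique → subst (ℤ._≤ ℤ.+ suc n) (sym (weight-+ w x)) (+≤+ (clique⇒light x clique)))

module _ {A : Set} where

  complement : {xs ys : List A} → xs ⊆ ys → List A
  complement []       = []
  complement (y ∷ʳ τ) = y ∷ complement τ
  complement (_ ∷ τ)  = complement τ

  length-complement : {xs ys : List A} (τ : xs ⊆ ys) → length xs + length (complement τ) ≡ length ys
  length-complement []                = refl
  length-complement {xs} (y ∷ʳ τ)     = trans (+-suc (length xs) _) (cong suc (length-complement τ))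
  length-complement (_ ∷ τ)           = cong suc (length-complement τ)

  ∈-complement : {xs ys : List A} (τ : xs ⊆ ys) {z : A} → z ∈ ys → z ∈ xs ⊎ z ∈ complement τ
  ∈-complement (y ∷ʳ τ) (here refl)   = inj₂ (here refl)
  ∈-complement (y ∷ʳ τ) (there z∈ys)  = map₂ there (∈-complement τ z∈ys)
  ∈-complement (refl ∷ τ) (here refl) = inj₁ (here refl)
  ∈-complement (refl ∷ τ) (there z∈ys) = map₁ there (∈-complement τ z∈ys)

2*m≤1+n+o⇒n<m⇒m≤o : ∀ {m n o} → 2 * m ≤ suc (n + o) → n < m → m ≤ o
2*m≤1+n+o⇒n<m⇒m≤o {m} {n} {o} 2m≤1+n+o n<m = +-cancelˡ-≤ m m o (begin
  m + m        ≡⟨ cong (m +_) (+-identityʳ m) ⟨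
  2 * m        ≤⟨ 2m≤1+n+o ⟩
  suc n + o    ≤⟨ +-monoˡ-≤ o n<m ⟩
  m + o        ∎)
  where open ≤-Reasoning

module _ {n} (G : Graph n) where

  open import Data.List.Membership.DecPropositional (_≟_ {n}) using (_∈?_)

  Homogeneous : Bool → List (Fin n) → Set
  Homogeneous b S = ∀ {u v} → u ∈ S → v ∈ S → u ≢ v → adj G u v ≡ b

  Homogeneous-∷ : ∀ {b S} v → (∀ {u} → u ∈ S → adj G v u ≡ b) → Homogeneous b S → Homogeneous b (v ∷ S)
  Homogeneous-∷ v v-S S-hom (here refl) (here refl) u≢w = contradiction refl u≢w
  Homogeneous-∷ v v-S S-hom (here refl) (there w∈S) _   = v-S w∈S
  Homogeneous-∷ v v-S S-hom (there u∈S) (here refl) _   = trans (Graph.sym G _ v) (v-S u∈S)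
  Homogeneous-∷ v v-S S-hom (there u∈S) (there w∈S)     = S-hom u∈S w∈S

  Homogeneous-[_] : ∀ {b} v → Homogeneous b (v ∷ [])
  Homogeneous-[ v ] = Homogeneous-∷ v (λ ()) (λ ())

  HomogeneousSublist : ℕ → ℕ → List (Fin n) → Set
  HomogeneousSublist a b X = ∃ λ S → S ⊆ X ×
    (Homogeneous true S × a < length S ⊎ Homogeneous false S × b < length S)

  module Neighbourhood (v : Fin n) (X : List (Fin n)) where

    adjacent? : Decidable (λ u → adj G v u ≡ true)
    adjacent? u = adj G v u Bool.≟ true

    N M : List (Fin n)
    N = filter adjacent? X
    M = filter (¬? ∘ adjacent?) X

    N-adjacent : ∀ {u} → u ∈ N → adj G v u ≡ true
    N-adjacent = proj₂ ∘ ∈-filter⁻ adjacent? {xs = X}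

    M-nonadjacent : ∀ {u} → u ∈ M → adj G v u ≡ false
    M-nonadjacent = ¬-not ∘ proj₂ ∘ ∈-filter⁻ (¬? ∘ adjacent?) {xs = X}

    length-N+M : length X ≡ length N + length M
    length-N+M = interleave-length (Interleaving.filter⁺ adjacent? X)

    joinN : ∀ {a b} → HomogeneousSublist a (suc b) N → HomogeneousSublist (suc a) (suc b) (v ∷ X)
    joinN (S , τ , inj₁ (clique , a<|S|)) =
      v ∷ S , refl ∷ ⊆-trans τ (filter-⊆ adjacent? X) ,
      inj₁ (Homogeneous-∷ v (N-adjacent ∘ Sublist.lookup τ) clique , s≤s a<|S|)
    joinN (S , τ , inj₂ independent) = S , v ∷ʳ ⊆-trans τ (filter-⊆ adjacent? X) , inj₂ independent

    joinM : ∀ {a b} → HomogeneousSublist (suc a) b M → HomogeneousSublist (suc a) (suc b) (v ∷ X)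
    joinM (S , τ , inj₁ clique) = S , v ∷ʳ ⊆-trans τ (filter-⊆ (¬? ∘ adjacent?) X) , inj₁ clique
    joinM (S , τ , inj₂ (independent , b<|S|)) =
      v ∷ S , refl ∷ ⊆-trans τ (filter-⊆ (¬? ∘ adjacent?) X) ,
      inj₂ (Homogeneous-∷ v (M-nonadjacent ∘ Sublist.lookup τ) independent , s≤s b<|S|)

  ramsey : ∀ a b X → 2 ^ (a + b) ≤ length X → HomogeneousSublist a b X
  ramsey a       b       []      2^[a+b]≤0 = contradiction 2^[a+b]≤0 (<⇒≱ (m^n>0 2 (a + b)))
  ramsey zero    b       (v ∷ X) _         = v ∷ [] , refl ∷ minimum X , inj₁ (Homogeneous-[ v ] , s≤s z≤n)
  ramsey (suc a) zero    (v ∷ X) _         = v ∷ [] , refl ∷ minimum X , inj₂ (Homogeneous-[ v ] , s≤s z≤n)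
  ramsey (suc a) (suc b) (v ∷ X) big with 2 ^ (a + suc b) ≤? length (Neighbourhood.N v X)
  ... | yes N-big  = Neighbourhood.joinN v X (ramsey a (suc b) _ N-big)
  ... | no N-small = Neighbourhood.joinM v X (ramsey (suc a) b _ M-big)
    where
    open Neighbourhood v X
    M-big : 2 ^ (suc a + b) ≤ length M
    M-big = subst (λ k → 2 ^ k ≤ length M) (+-suc a b)
      (2*m≤1+n+o⇒n<m⇒m≤o (subst (λ k → 2 ^ (suc a + suc b) ≤ suc k) length-N+M big) (≰⇒> N-small))

  starRole : Fin n → Fin n → Role
  starRole w v = if does (v ≟ w) then centre else neighbourRole (adj G w v)

  star : Fin n → Graph n
  star w = roleGraph (starRole w)

  starRole-≢ : ∀ {w v} → v ≢ w → starRole w v ≡ neighbourRole (adj G w v)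
  starRole-≢ {w} {v} v≢w = cong (if_then centre else neighbourRole (adj G w v)) (dec-false (v ≟ w) v≢w)

  starRole-centre : ∀ {w} → starRole w w ≡ centre
  starRole-centre {w} = cong (if_then centre else neighbourRole (adj G w w)) (dec-true (w ≟ w) refl)

  star-adj-centre : ∀ {w v} → w ≢ v → adj (star w) w v ≡ adj G w v
  star-adj-centre {w} {v} w≢v = begin
    adj (star w) w v                         ≡⟨ roleGraph-adj (starRole w) w≢v ⟩
    compatible (starRole w w) (starRole w v) ≡⟨ cong₂ compatible starRole-centre (starRole-≢ (w≢v ∘ sym)) ⟩
    compatible centre (neighbourRole (adj G w v)) ≡⟨ compatible-centre-neighbour (adj G w v) ⟩
    adj G w v                                ∎
    where open ≡-Reasoning

  edge⇒star-edge : ∀ w {u v} → u ≢ v → adj G u v ≡ true → adj (star w) u v ≡ true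
  edge⇒star-edge w {u} {v} u≢v uv = by-cases (u ≟ w) (v ≟ w)
    where
    open ≡-Reasoning
    by-cases : Dec (u ≡ w) → Dec (v ≡ w) → adj (star w) u v ≡ true
    by-cases (yes refl) _          = trans (star-adj-centre u≢v) uv
    by-cases (no _)     (yes refl) = begin
      adj (star v) u v   ≡⟨ Graph.sym (star v) u v ⟩
      adj (star v) v u   ≡⟨ star-adj-centre (u≢v ∘ sym) ⟩
      adj G v u          ≡⟨ Graph.sym G v u ⟩
      adj G u v          ≡⟨ uv ⟩
      true               ∎
    by-cases (no u≢w)   (no v≢w)   = begin
      adj (star w) u v                                         ≡⟨ roleGraph-adj (starRole w) u≢v ⟩
      compatible (starRole w u) (starRole w v)                 ≡⟨ cong₂ compatible (starRole-≢ u≢w) (starRole-≢ v≢w) ⟩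
      compatible (neighbourRole (adj G w u)) (neighbourRole (adj G w v)) ≡⟨ compatible-neighbours (adj G w u) (adj G w v) ⟩
      true                                                     ∎

  -- For S homogeneous of colour b, roleGraph (innerRole b S) agrees with G on S and is complete
  -- elsewhere.
  innerRole : Bool → List (Fin n) → Fin n → Role
  innerRole true  S v = free
  innerRole false S v = if does (v ∈? S) then centre else free

  inner-adj : ∀ b {S u v} → u ∈ S → v ∈ S → u ≢ v → adj (roleGraph (innerRole b S)) u v ≡ b
  inner-adj true {S} u∈S v∈S u≢v = roleGraph-adj (innerRole true S) u≢v
  inner-adj false {S} {u} {v} u∈S v∈S u≢v = begin
    adj (roleGraph (innerRole false S)) u v            ≡⟨ roleGraph-adj (innerRole false S) u≢v ⟩
    compatible (innerRole false S u) (innerRole false S v)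
      ≡⟨ cong₂ compatible (cong (if_then centre else free) (dec-true (u ∈? S) u∈S))
                          (cong (if_then centre else free) (dec-true (v ∈? S) v∈S)) ⟩
    compatible centre centre                           ∎
    where open ≡-Reasoning

  innerRole-∉ : ∀ b {S v} → ¬ (v ∈ S) → innerRole b S v ≡ free
  innerRole-∉ true  _ = refl
  innerRole-∉ false {S} {v} v∉S = cong (if_then centre else free) (dec-false (v ∈? S) v∉S)

  edge⇒inner-edge : ∀ {b S u v} → Homogeneous b S → u ≢ v → adj G u v ≡ true →
                    adj (roleGraph (innerRole b S)) u v ≡ true
  edge⇒inner-edge {b} {S} {u} {v} S-hom u≢v uv = by-cases (u ∈? S) (v ∈? S)
    where
    H₀ : Graph n
    H₀ = roleGraph (innerRole b S)
    by-cases : Dec (u ∈ S) → Dec (v ∈ S) → adj H₀ u v ≡ true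
    by-cases (yes u∈S) (yes v∈S) = trans (inner-adj b u∈S v∈S u≢v) (trans (sym (S-hom u∈S v∈S u≢v)) uv)
    by-cases (no u∉S)  _         =
      trans (roleGraph-adj (innerRole b S) u≢v) (cong (λ r → compatible r (innerRole b S v)) (innerRole-∉ b u∉S))
    by-cases (yes _)   (no v∉S)  =
      trans (roleGraph-adj (innerRole b S) u≢v) (trans (cong (compatible (innerRole b S u)) (innerRole-∉ b v∉S)) (compatible-free _))

  homogeneous⇒dimTH≤ : ∀ {b S} → S ⊆ allFin n → Homogeneous b S → dimTH≤ G (suc (n ∸ length S))
  homogeneous⇒dimTH≤ {b} {S} τ S-hom =
    subst (ThresholdRep G ∘ suc) |outside|≡n∸|S| (H , H-threshold , λ u v u≢v → forward u≢v , backward u≢v)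
    where
    outside : List (Fin n)
    outside = complement τ

    |outside|≡n∸|S| : length outside ≡ n ∸ length S
    |outside|≡n∸|S| = begin
      length outside                          ≡⟨ m+n∸m≡n (length S) (length outside) ⟨
      length S + length outside ∸ length S    ≡⟨ cong (_∸ length S) (trans (length-complement τ) (length-tabulate id)) ⟩
      n ∸ length S                            ∎
      where open ≡-Reasoning

    H : Fin (suc (length outside)) → Graph n
    H zero    = roleGraph (innerRole b S)
    H (suc i) = star (lookup outside i)

    H-threshold : ∀ i → IsThreshold (H i)
    H-threshold zero    = roleGraph-isThreshold (innerRole b S)
    H-threshold (suc i) = roleGraph-isThreshold (starRole (lookup outside i))

    forward : ∀ {u v} → u ≢ v → adj G u v ≡ true → ∀ i → adj (H i) u v ≡ true
    forward u≢v uv zero    = edge⇒inner-edge S-hom u≢v uv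
    forward u≢v uv (suc i) = edge⇒star-edge (lookup outside i) u≢v uv

    star-edge : ∀ {u v w} → (∀ i → adj (H i) u v ≡ true) → w ∈ outside → adj (star w) u v ≡ true
    star-edge {u} {v} uv w∈out =
      subst (λ w → adj (star w) u v ≡ true) (sym (lookup-index w∈out)) (uv (suc (index w∈out)))

    backward : ∀ {u v} → u ≢ v → (∀ i → adj (H i) u v ≡ true) → adj G u v ≡ true
    backward {u} {v} u≢v uv with ∈-complement τ (∈-allFin u) | ∈-complement τ (∈-allFin v)
    ... | inj₂ u∈out | _          = trans (sym (star-adj-centre u≢v)) (star-edge uv u∈out)
    ... | inj₁ _     | inj₂ v∈out = begin
      adj G u v         ≡⟨ Graph.sym G u v ⟩
      adj G v u         ≡⟨ star-adj-centre (u≢v ∘ sym) ⟨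
      adj (star v) v u  ≡⟨ Graph.sym (star v) v u ⟩
      adj (star v) u v  ≡⟨ star-edge uv v∈out ⟩
      true              ∎
      where open ≡-Reasoning
    ... | inj₁ u∈S   | inj₁ v∈S   = trans (S-hom u∈S v∈S u≢v) (trans (sym (inner-adj b u∈S v∈S u≢v)) (uv zero))

  dimTH≤n∸c : ∀ c → 2 ^ (c + c) ≤ n → ∃ λ k → dimTH≤ G k × c + k ≤ n
  dimTH≤n∸c c 2^[c+c]≤n =
    from-homogeneous (ramsey c c (allFin n) (subst (2 ^ (c + c) ≤_) (sym |V|≡n) 2^[c+c]≤n))
    where
    |V|≡n : length (allFin n) ≡ n
    |V|≡n = length-tabulate id

    from-homogeneous : HomogeneousSublist c c (allFin n) → ∃ λ k → dimTH≤ G k × c + k ≤ n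
    from-homogeneous (S , τ , hom) =
      suc (n ∸ length S) ,
      [ homogeneous⇒dimTH≤ τ ∘ proj₁ , homogeneous⇒dimTH≤ τ ∘ proj₁ ]′ hom ,
      (begin
        c + suc (n ∸ length S)    ≡⟨ +-suc c (n ∸ length S) ⟩
        suc c + (n ∸ length S)    ≤⟨ +-monoˡ-≤ (n ∸ length S) ([ proj₂ , proj₂ ]′ hom) ⟩
        length S + (n ∸ length S) ≡⟨ m+[n∸m]≡n (subst (length S ≤_) |V|≡n (length-mono-≤ τ)) ⟩
        n                         ∎)
      where open ≤-Reasoning

fact≡! : ∀ n → fact n ≡ n !
fact≡! zero    = refl
fact≡! (suc n) = cong (suc n *_) (fact≡! n)

a^m*b^n*[m+n]!≤[a+b]^[m+n]*m!*n! : ∀ a b m n →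
  a ^ m * b ^ n * (m + n) ! ≤ (a + b) ^ (m + n) * (m ! * n !)
a^m*b^n*[m+n]!≤[a+b]^[m+n]*m!*n! a b zero n = begin
  1 * b ^ n * n !         ≡⟨ cong (_* n !) (*-identityˡ (b ^ n)) ⟩
  b ^ n * n !             ≤⟨ *-monoˡ-≤ (n !) (^-monoˡ-≤ n (m≤n+m b a)) ⟩
  (a + b) ^ n * n !       ≡⟨ cong ((a + b) ^ n *_) (sym (+-identityʳ (n !))) ⟩
  (a + b) ^ n * (1 * n !) ∎
  where open ≤-Reasoning
a^m*b^n*[m+n]!≤[a+b]^[m+n]*m!*n! a b m@(suc _) zero = begin
  a ^ m * 1 * (m + 0) !     ≡⟨ cong₂ (λ x k → x * k !) (*-identityʳ (a ^ m)) (+-identityʳ m) ⟩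
  a ^ m * m !               ≤⟨ *-monoˡ-≤ (m !) (^-monoˡ-≤ m (m≤m+n a b)) ⟩
  (a + b) ^ m * m !         ≡⟨ cong₂ (λ k x → (a + b) ^ k * x) (sym (+-identityʳ m)) (sym (*-identityʳ (m !))) ⟩
  (a + b) ^ (m + 0) * (m ! * 1) ∎
  where open ≤-Reasoning
a^m*b^n*[m+n]!≤[a+b]^[m+n]*m!*n! a b (suc m) (suc n) = begin
  a * a ^ m * (b * b ^ n) * suc K !
    ≡⟨ cong (λ k → a * a ^ m * (b * b ^ n) * (suc k * K !)) (+-suc m n) ⟩
  a * a ^ m * (b * b ^ n) * ((2 + (m + n)) * K !)
    ≡⟨ split-factor a b m n (a ^ m) (b ^ n) (K !) ⟩
  a * suc m * (a ^ m * (b * b ^ n) * K !) + b * suc n * (a * a ^ m * b ^ n * K !)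
    ≤⟨ +-mono-≤ (*-monoʳ-≤ (a * suc m) (a^m*b^n*[m+n]!≤[a+b]^[m+n]*m!*n! a b m (suc n)))
                (*-monoʳ-≤ (b * suc n) shifted) ⟩
  a * suc m * ((a + b) ^ K * (m ! * suc n !)) + b * suc n * ((a + b) ^ K * (suc m ! * n !))
    ≡⟨ merge-factor a b m n ((a + b) ^ K) (m !) (n !) ⟩
  (a + b) ^ suc K * (suc m ! * suc n !) ∎
  where
  open ≤-Reasoning
  K = m + suc n
  shifted : a * a ^ m * b ^ n * K ! ≤ (a + b) ^ K * (suc m ! * n !)
  shifted = subst (λ k → a * a ^ m * b ^ n * k ! ≤ (a + b) ^ k * (suc m ! * n !)) (sym (+-suc m n))
                  (a^m*b^n*[m+n]!≤[a+b]^[m+n]*m!*n! a b (suc m) n)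
  split-factor : ∀ a b m n x y f →
    a * x * (b * y) * ((2 + (m + n)) * f) ≡ a * suc m * (x * (b * y) * f) + b * suc n * (a * x * y * f)
  split-factor = solve-∀
  merge-factor : ∀ a b m n e f g →
    a * suc m * (e * (f * (suc n * g))) + b * suc n * (e * (suc m * f * g)) ≡ (a + b) * e * (suc m * f * (suc n * g))
  merge-factor = solve-∀

-- e^x ≥ y, witnessed by the single term x^N/N! of the exponential series.
ExpTermGe : ℕ → ℕ → Set
ExpTermGe x y = ∃ λ N → y * N ! ≤ x ^ N

x^N≤expNum : ∀ x N → x ^ N ≤ expNum x N
x^N≤expNum x zero    = ≤-refl
x^N≤expNum x (suc N) = m≤n+m (x ^ suc N) (suc N * expNum x N)

ExpTermGe⇒ExpGe : ∀ {x y} → ExpTermGe x y → ExpGe x y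
ExpTermGe⇒ExpGe {x} {y} (N , le) =
  N , subst (λ f → y * f ≤ expNum x N) (sym (fact≡! N)) (≤-trans le (x^N≤expNum x N))

ExpTermGe-mono : ∀ {x x′ y y′} → x ≤ x′ → y′ ≤ y → ExpTermGe x y → ExpTermGe x′ y′
ExpTermGe-mono x≤x′ y′≤y (N , le) = N , ≤-trans (*-monoˡ-≤ (N !) y′≤y) (≤-trans le (^-monoˡ-≤ N x≤x′))

ExpTermGe-+ : ∀ {a b y z} → ExpTermGe a y → ExpTermGe b z → ExpTermGe (a + b) (y * z)
ExpTermGe-+ {a} {b} {y} {z} (N , le₁) (M , le₂) =
  N + M , *-cancelʳ-≤ (y * z * (N + M) !) ((a + b) ^ (N + M)) (N ! * M !) {{N !* M !≢0}} (begin
    y * z * (N + M) ! * (N ! * M !)   ≡⟨ regroup y z (N !) (M !) ((N + M) !) ⟩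
    y * N ! * (z * M !) * (N + M) !   ≤⟨ *-monoˡ-≤ ((N + M) !) (*-mono-≤ le₁ le₂) ⟩
    a ^ N * b ^ M * (N + M) !         ≤⟨ a^m*b^n*[m+n]!≤[a+b]^[m+n]*m!*n! a b N M ⟩
    (a + b) ^ (N + M) * (N ! * M !)   ∎)
  where
  open ≤-Reasoning
  regroup : ∀ y z f g h → y * z * h * (f * g) ≡ y * f * (z * g) * h
  regroup = solve-∀

ExpTermGe-^ : ∀ {a y} → ExpTermGe a y → ∀ q → ExpTermGe (q * a) (y ^ q)
ExpTermGe-^         e zero    = 0 , ≤-refl
ExpTermGe-^ {a} {y} e (suc q) = ExpTermGe-+ {a} {q * a} {y} {y ^ q} e (ExpTermGe-^ e q)

-- By evaluation: 5000^5000/5000! ≈ e^4994.8, while 2^7205 ≈ e^4994.1.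
e^[25*200]≥2^[36*200+5] : ExpTermGe (25 * 200) (2 ^ (36 * 200 + 5))
e^[25*200]≥2^[36*200+5] = 5000 , ≤ᵇ⇒≤ _ _ _

floor-log : ∀ {B} → 1 < B → ∀ {n} → 0 < n → ∃ λ t → B ^ t ≤ n × n < B ^ suc t
floor-log {B} 1<B {suc zero} _ = 0 , ≤-refl , subst (1 <_) (sym (*-identityʳ B)) 1<B
floor-log {B} 1<B {suc (suc m)} _ with floor-log 1<B {suc m} z<s
... | t , lower , upper with suc (suc m) <? B ^ suc t
...   | yes below = t , m≤n⇒m≤1+n lower , below
...   | no notBelow = suc t , ≮⇒≥ notBelow , (begin-strict
  suc (suc m)     ≤⟨ upper ⟩
  B ^ suc t       <⟨ m<m*n (B ^ suc t) B 1<B ⟩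
  B ^ suc t * B   ≡⟨ *-comm (B ^ suc t) B ⟩
  B ^ suc (suc t) ∎)
  where
  open ≤-Reasoning
  instance
    B≢0 : NonZero B
    B≢0 = >-nonZero (<-trans z<s 1<B)
    B^[1+t]≢0 : NonZero (B ^ suc t)
    B^[1+t]≢0 = m^n≢0 B (suc t)

-- With (4^L)^t ≤ n < (4^L)^(t+1) and c = L t we get n^18 < 2^(36L(t+1)) ≤ 2^((36L+s)t) ≤ e^(25Lt)
-- as soon as s t ≥ 36 L, which n ≥ (4^L)^t₀ guarantees.
log₄-witness : ∀ {L s t₀} → 0 < L → ExpTermGe (25 * L) (2 ^ (36 * L + s)) → 36 * L ≤ s * t₀ →
               ∀ {n} → 0 < n → (4 ^ L) ^ t₀ ≤ n →
               ∃ λ c → 2 ^ (c + c) ≤ n × ExpTermGe (25 * c) (n ^ 18)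
log₄-witness {L} {s} {t₀} 0<L base 36L≤st₀ {n} 0<n n₀≤n =
  let t , lower , upper = floor-log 1<4^L 0<n
  in L * t ,
     subst (_≤ n) (4^[Lt]≡2^[Lt+Lt] t) lower ,
     ExpTermGe-mono (≤-reflexive (t[25L]≡25[Lt] L t)) (n^18≤ {t} upper) (ExpTermGe-^ base t)
  where
  instance
    4^L≢0 : NonZero (4 ^ L)
    4^L≢0 = m^n≢0 4 L
  4^[Lt]≡2^[Lt+Lt] : ∀ t → (4 ^ L) ^ t ≡ 2 ^ (L * t + L * t)
  4^[Lt]≡2^[Lt+Lt] t = begin
    (4 ^ L) ^ t                 ≡⟨ ^-*-assoc 4 L t ⟩
    4 ^ (L * t)                 ≡⟨ ^-*-assoc 2 2 (L * t) ⟩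
    2 ^ (L * t + 1 * (L * t))   ≡⟨ cong (λ k → 2 ^ (L * t + k)) (*-identityˡ (L * t)) ⟩
    2 ^ (L * t + L * t)         ∎
    where open ≡-Reasoning
  1<4^L : 1 < 4 ^ L
  1<4^L = ≤-trans (s≤s (s≤s z≤n)) (^-monoʳ-≤ 4 0<L)
  t[25L]≡25[Lt] : ∀ L t → t * (25 * L) ≡ 25 * (L * t)
  t[25L]≡25[Lt] = solve-∀

  n^18≤ : ∀ {t} → n < (4 ^ L) ^ suc t → n ^ 18 ≤ (2 ^ (36 * L + s)) ^ t
  n^18≤ {t} upper = begin
    n ^ 18                              ≤⟨ ^-monoˡ-≤ 18 (<⇒≤ upper) ⟩
    ((4 ^ L) ^ suc t) ^ 18              ≡⟨ ^-*-assoc (4 ^ L) (suc t) 18 ⟩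
    (4 ^ L) ^ (suc t * 18)              ≡⟨ ^-*-assoc 4 L (suc t * 18) ⟩
    4 ^ (L * (suc t * 18))              ≡⟨ ^-*-assoc 2 2 (L * (suc t * 18)) ⟩
    2 ^ (2 * (L * (suc t * 18)))        ≡⟨ cong (2 ^_) (exponent L t) ⟩
    2 ^ (36 * L + 36 * L * t)           ≤⟨ ^-monoʳ-≤ 2 (+-monoˡ-≤ (36 * L * t) 36L≤st) ⟩
    2 ^ (s * t + 36 * L * t)            ≡⟨ cong (2 ^_) (regroup L s t) ⟩
    2 ^ ((36 * L + s) * t)              ≡⟨ ^-*-assoc 2 (36 * L + s) t ⟨
    (2 ^ (36 * L + s)) ^ t              ∎
    where
    open ≤-Reasoning
    t₀≤t : t₀ ≤ t
    t₀≤t = ≮⇒≥ λ t<t₀ → <⇒≱ upper (≤-trans (^-monoʳ-≤ (4 ^ L) t<t₀) n₀≤n)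
    36L≤st : 36 * L ≤ s * t
    36L≤st = ≤-trans 36L≤st₀ (*-monoʳ-≤ s t₀≤t)
    exponent : ∀ L t → 2 * (L * (suc t * 18)) ≡ 36 * L + 36 * L * t
    exponent = solve-∀
    regroup : ∀ L s t → s * t + 36 * L * t ≡ (36 * L + s) * t
    regroup = solve-∀

LeNMinus072Ln-intro : ∀ {k n} c → c + k ≤ n → ExpTermGe (25 * c) (n ^ 18) → LeNMinus072Ln k n
LeNMinus072Ln-intro {k} {n} c c+k≤n e^25c≥n^18 =
  m+n≤o⇒n≤o c c+k≤n ,
  ExpTermGe⇒ExpGe {y = n ^ 18}
    (ExpTermGe-mono {y = n ^ 18} (*-monoʳ-≤ 25 (m+n≤o⇒m≤o∸n c c+k≤n)) ≤-refl e^25c≥n^18)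

corollary5 : ∃ λ (n₀ : ℕ) → ∀ (n : ℕ) → 1 ≤ n → n₀ ≤ n →
    ∀ (G : Graph n) → ∃ λ (k : ℕ) → dimTH≤ G k × LeNMinus072Ln k n
corollary5 = (4 ^ 200) ^ 1440 , λ n 1≤n n₀≤n G →
  let c , 2^[c+c]≤n , e^25c≥n^18 =
        log₄-witness {200} {5} {1440} (s≤s z≤n) e^[25*200]≥2^[36*200+5] ≤-refl 1≤n n₀≤n
      k , dim≤k , c+k≤n = dimTH≤n∸c G c 2^[c+c]≤n
  in k , dim≤k , LeNMinus072Ln-intro c c+k≤n e^25c≥n^18
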